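{- Let $T_1,T_2$ be trees of order at least three, and let $v$ be the root vertex of $T_2$. Then $\gamma_c(T_1\circ T_2)=n(T_1)\gamma_c(T_2)$ if and only if $v$ is not an end vertex (vertex of degree one) of $T_2$.
   Context: All graphs are finite, simple and undirected; $n(T)$ denotes the order of $T$. A connected dominating set of a connected graph is a set $D$ of vertices such that every vertex outside $D$ has a neighbor in $D$ and $D$ induces a connected subgraph; $\gamma_c$ is the minimum cardinality of such a set. For $G$ with vertex set $\{v_1,\dots,v_n\}$ and $H$ with root $v$, the rooted product $G\circ H$ is obtained from one copy of $G$ and $n$ copies $H_1,\dots,H_n$ of $H$ by identifying each $v_i$ with the copy of $v$ in $H_i$. -}

module Defs where

open import Data.Nat using (ℕ; _≤_; _<_)
open import Data.Bool using (Bool; true; false; T; _∧_; _∨_; if_then_else_)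
open import Data.Fin using (Fin; remQuot; _≟_)
open import Data.Fin.Subset using (Subset; _∈_; _∉_; ∣_∣)
open import Data.Vec using (tabulate)
open import Data.List using (List; []; _∷_; _++_; length)
open import Data.List.Relation.Unary.Unique.Propositional using (Unique)
open import Data.List.Relation.Unary.Linked using (Linked)
open import Data.Product using (Σ; ∃; _×_; _,_)
open import Data.Unit using (⊤)
open import Relation.Nullary using (¬_)
open import Relation.Nullary.Decidable using (⌊_⌋)
open import Relation.Binary.PropositionalEquality using (_≡_)

Graph : ℕ → Set
Graph n = Fin n → Fin n → Bool

Simple : ∀ {n} → Graph n → Set
Simple {n} G = (∀ (x y : Fin n) → G x y ≡ G y x) × (∀ (x : Fin n) → G x x ≡ false)

data Walk {n : ℕ} (G : Graph n) (P : Fin n → Set) : Fin n → Fin n → Set where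
  here : ∀ {x} → P x → Walk G P x x
  step : ∀ {x y z} → P x → T (G x y) → Walk G P y z → Walk G P x z

Connected : ∀ {n} → Graph n → Set
Connected G = ∀ x y → Walk G (λ _ → ⊤) x y

-- A cycle: distinct vertices x, z₁ … zₖ, y (k ≥ 1, so at least 3 vertices),
-- consecutive ones adjacent, and y adjacent to x.
HasCycle : ∀ {n} → Graph n → Set
HasCycle {n} G =
  Σ (Fin n) λ x → Σ (List (Fin n)) λ zs → Σ (Fin n) λ y →
    (1 ≤ length zs) × Unique (x ∷ zs ++ y ∷ []) ×
    Linked (λ a b → T (G a b)) (x ∷ zs ++ y ∷ []) × T (G y x)

Tree : ∀ {n} → Graph n → Set
Tree G = Simple G × Connected G × ¬ HasCycle G

degree : ∀ {n} → Graph n → Fin n → ℕ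
degree G x = ∣ tabulate (G x) ∣

IsConnDomSet : ∀ {n} → Graph n → Subset n → Set
IsConnDomSet {n} G D =
  (∀ x → x ∉ D → ∃ λ y → y ∈ D × T (G x y)) ×
  (∀ x y → x ∈ D → y ∈ D → Walk G (λ z → z ∈ D) x y)

IsConnDomNumber : ∀ {n} → Graph n → ℕ → Set
IsConnDomNumber {n} G k =
  (∃ λ (D : Subset n) → IsConnDomSet G D × ∣ D ∣ ≡ k) ×
  (∀ (D : Subset n) → IsConnDomSet G D → k ≤ ∣ D ∣)

-- Rooted product G ∘ H with root v of H. Vertex a ∈ Fin (n₁ * n₂) is the pair
-- (i , j) = remQuot n₂ a: vertex j of the i-th copy Hᵢ of H; the vertex (i , v)
-- is identified with vertex i of G.
rootedProduct : ∀ {n₁ n₂} → Graph n₁ → Graph n₂ → Fin n₂ → Graph (n₁ Data.Nat.* n₂)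
rootedProduct {n₁} {n₂} G H v a b with remQuot {n₁} n₂ a | remQuot {n₁} n₂ b
... | (i , j) | (i' , j') =
  (⌊ i ≟ i' ⌋ ∧ H j j') ∨ (⌊ j ≟ v ⌋ ∧ ⌊ j' ≟ v ⌋ ∧ G i i')

module Submission where

-- Write P = T₁ ∘ T₂ with root v, γ = γc(P) and γ₂ = γc(T₂).
--
-- A connected dominating set D of P
-- meets every copy of T₂; since it also meets some other copy and is
-- connected, it contains every root (i , v).  Projecting onto copy i
-- (collapsing the other copies onto the root) shows that the part of D in
-- copy i is a connected dominating set of T₂ containing v.  Hence
-- |D| = Σᵢ |Dᵢ| ≥ n₁ γ₂, and equality forces every Dᵢ to be minimum.
-- Conversely a minimum set of T₂ through v, repeated in every copy, is a
-- connected dominating set of P of size n₁ γ₂.  So γ = n₁ γ₂ iff some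
-- minimum connected dominating set of T₂ contains v.
--
-- If v has two distinct neighbours it is a cut vertex, hence lies
-- in every connected dominating set (a walk around it would close a cycle).
-- If v is a leaf, then in a graph with a third vertex it can be removed from
-- any connected dominating set, which is therefore not minimum.

open import Defs
open import Data.Bool using (Bool; true; false; T; _∧_; _∨_)
open import Data.Bool.Properties using (T-≡; T-∨; T-∧)
open import Data.Empty using (⊥-elim)
open import Data.Fin as Fin using (Fin; zero; suc; combine; remQuot; _↑ˡ_; _↑ʳ_; _≟_)
open import Data.Fin.Properties using (remQuot-combine; combine-remQuot; any?)
open import Data.Fin.Subset using (Subset; _∈_; _∉_; ∣_∣; _-_; ⁅_⁆)
open import Data.Fin.Subset.Properties
  using (_∈?_; p─q⊆p; x∈p∧x≢y⇒x∈p-y; x∈p⇒∣p-x∣<∣p∣; ⊆-antisym; x∈⁅x⁆; x∈⁅y⁆⇒x≡y; ∣⁅x⁆∣≡1)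
open import Data.List using (List; []; _∷_; _++_)
open import Data.List.Relation.Unary.All as All using (All; []; _∷_)
open import Data.List.Relation.Unary.All.Properties using (¬Any⇒All¬)
open import Data.List.Relation.Unary.Any as Any using (Any)
open import Data.List.Relation.Unary.AllPairs using ([]; _∷_)
open import Data.List.Relation.Unary.Linked using (Linked; [-]; _∷_)
open import Data.List.Relation.Unary.Unique.Propositional using (Unique)
open import Data.Nat using (ℕ; zero; suc; _+_; _*_; _≤_; _<_; z≤n; s≤s)
open import Data.Nat.Properties
  using (+-0-monoid; +-assoc; +-mono-≤; +-monoʳ-≤; +-cancelʳ-≤; +-cancelˡ-≡;
         ≤-reflexive; ≤-trans; ≤-antisym; ≤-<-trans; <-irrefl; n≤1+n)
open import Data.Product using (Σ; ∃; _×_; _,_; proj₁; proj₂)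
open import Data.Sum using (_⊎_; inj₁; inj₂)
open import Data.Unit using (⊤)
open import Data.Vec using (lookup; tabulate; []; _∷_; there)
open import Data.Vec.Properties using (lookup∘tabulate; tabulate∘lookup; tabulate-cong; []=⇒lookup; lookup⇒[]=)
open import Function.Bundles using (_⇔_; mk⇔; Equivalence)
open import Function.Construct.Composition using (_⇔-∘_)
open import Relation.Nullary using (¬_; yes; no)
open import Relation.Nullary.Decidable using (⌊_⌋; toWitness; fromWitness; decidable-stable; ¬?; _×-dec_; T?)
open import Relation.Binary.PropositionalEquality
  using (_≡_; _≢_; refl; sym; trans; cong; cong₂; subst; subst₂; ≢-sym; module ≡-Reasoning)

open import Algebra.Properties.Monoid.Sum +-0-monoid using (sum; sum-cong-≗; sum-syntax)

open Equivalence using (to; from)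

sum-++ : ∀ a {b} (g : Fin (a + b) → ℕ) →
         sum g ≡ sum (λ i → g (i ↑ˡ b)) + sum (λ j → g (a ↑ʳ j))
sum-++ zero    g = refl
sum-++ (suc a) g =
  trans (cong (g zero +_) (sum-++ a (λ i → g (suc i)))) (sym (+-assoc (g zero) _ _))

sum-combine : ∀ m n (g : Fin (m * n) → ℕ) →
              sum g ≡ ∑[ i < m ] ∑[ j < n ] g (combine i j)
sum-combine zero    n g = refl
sum-combine (suc m) n g =
  trans (sum-++ n g) (cong (sum (λ j → g (j ↑ˡ m * n)) +_) (sum-combine m n (λ a → g (n ↑ʳ a))))

sum-const : ∀ m c → ∑[ i < m ] c ≡ m * c
sum-const zero    c = refl
sum-const (suc m) c = cong (c +_) (sum-const m c)

sum-lower : ∀ {m} (g : Fin m → ℕ) {c} → (∀ i → c ≤ g i) → m * c ≤ sum g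
sum-lower {zero}  g low = z≤n
sum-lower {suc m} g low = +-mono-≤ (low zero) (sum-lower (λ i → g (suc i)) (λ i → low (suc i)))

sum-tight : ∀ {m} (g : Fin m → ℕ) {c} → (∀ i → c ≤ g i) → sum g ≡ m * c → ∀ i → g i ≡ c
sum-tight {suc m} g {c} low total zero = ≤-antisym first≤c (low zero)
  where
  rest : ℕ
  rest = sum (λ i → g (suc i))
  first≤c : g zero ≤ c
  first≤c = +-cancelʳ-≤ rest (g zero) c
    (≤-trans (≤-reflexive total) (+-monoʳ-≤ c (sum-lower (λ i → g (suc i)) (λ i → low (suc i)))))
sum-tight {suc m} g {c} low total (suc i) =
  sum-tight (λ i → g (suc i)) (λ i → low (suc i)) rest≡ i
  where
  rest≡ : sum (λ i → g (suc i)) ≡ m * c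
  rest≡ = +-cancelˡ-≡ c _ _ (trans (cong (_+ _) (sym (sum-tight g low total zero))) total)

indicator : Bool → ℕ
indicator true  = 1
indicator false = 0

count : ∀ {n} → (Fin n → Bool) → ℕ
count {n} f = ∑[ i < n ] indicator (f i)

size-count : ∀ {n} (D : Subset n) → ∣ D ∣ ≡ count (lookup D)
size-count []          = refl
size-count (true ∷ D)  = cong suc (size-count D)
size-count (false ∷ D) = size-count D

∈-tabulate⁺ : ∀ {n} {f : Fin n → Bool} {x} → f x ≡ true → x ∈ tabulate f
∈-tabulate⁺ {f = f} {x} fx = lookup⇒[]= x (tabulate f) (trans (lookup∘tabulate f x) fx)

∈-tabulate⁻ : ∀ {n} {f : Fin n → Bool} {x} → x ∈ tabulate f → f x ≡ true
∈-tabulate⁻ {f = f} {x} x∈ = trans (sym (lookup∘tabulate f x)) ([]=⇒lookup x∈)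

size-tabulate : ∀ {n} (f : Fin n → Bool) → ∣ tabulate f ∣ ≡ count f
size-tabulate f =
  trans (size-count (tabulate f)) (sum-cong-≗ (λ i → cong indicator (lookup∘tabulate f i)))

preimage : ∀ {m n} → (Fin m → Fin n) → Subset n → Subset m
preimage φ D = tabulate (λ x → lookup D (φ x))

module _ {m n} {φ : Fin m → Fin n} {D : Subset n} {x : Fin m} where
  ∈-preimage⁺ : φ x ∈ D → x ∈ preimage φ D
  ∈-preimage⁺ φx∈D = ∈-tabulate⁺ ([]=⇒lookup φx∈D)

  ∈-preimage⁻ : x ∈ preimage φ D → φ x ∈ D
  ∈-preimage⁻ x∈ = lookup⇒[]= (φ x) D (∈-tabulate⁻ x∈)

x∉p-x : ∀ {n} (D : Subset n) x → x ∉ D - x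
x∉p-x (s ∷ D) zero    ()
x∉p-x (s ∷ D) (suc x) (there x∈) = x∉p-x D x x∈

∈-remove⁻ : ∀ {n} {D : Subset n} {x y} → x ∈ D - y → x ∈ D × x ≢ y
∈-remove⁻ {D = D} {y = y} x∈ = p─q⊆p D ⁅ y ⁆ x∈ , λ { refl → x∉p-x D y x∈ }

distinct⇒2≤size : ∀ {n} {D : Subset n} {x y} → x ∈ D → y ∈ D → x ≢ y → 2 ≤ ∣ D ∣
distinct⇒2≤size {D = D} x∈D y∈D x≢y =
  ≤-trans (s≤s (≤-trans (s≤s z≤n) (x∈p⇒∣p-x∣<∣p∣ (x∈p∧x≢y⇒x∈p-y y∈D (≢-sym x≢y)))))
          (x∈p⇒∣p-x∣<∣p∣ x∈D)

only-element⇒size≡1 : ∀ {n} {D : Subset n} {u} → u ∈ D → (∀ {x} → x ∈ D → x ≡ u) → ∣ D ∣ ≡ 1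
only-element⇒size≡1 {D = D} {u} u∈D only = trans (cong ∣_∣ D≡⁅u⁆) (∣⁅x⁆∣≡1 u)
  where
  D≡⁅u⁆ : D ≡ ⁅ u ⁆
  D≡⁅u⁆ = ⊆-antisym (λ x∈D → subst (_∈ ⁅ u ⁆) (sym (only x∈D)) (x∈⁅x⁆ u))
                    (λ x∈⁅u⁆ → subst (_∈ D) (sym (x∈⁅y⁆⇒x≡y u x∈⁅u⁆)) u∈D)

module _ {n} {G : Graph n} where
  walk-source : ∀ {P x y} → Walk G P x y → P x
  walk-source (here p)     = p
  walk-source (step p _ _) = p

  infixr 5 _++ʷ_
  _++ʷ_ : ∀ {P x y z} → Walk G P x y → Walk G P y z → Walk G P x z
  here _       ++ʷ w′ = w′
  step p e w   ++ʷ w′ = step p e (w ++ʷ w′)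

  walk-reverse : (∀ x y → G x y ≡ G y x) → ∀ {P x y} → Walk G P x y → Walk G P y x
  walk-reverse symmetric (here p)     = here p
  walk-reverse symmetric (step p e w) =
    walk-reverse symmetric w ++ʷ step (walk-source w) (subst T (symmetric _ _) e) (here p)

walk-map : ∀ {n m} {G : Graph n} {H : Graph m} {P : Fin n → Set} {Q : Fin m → Set}
           (φ : Fin n → Fin m) → (∀ {z} → P z → Q (φ z)) →
           (∀ {z z′} → T (G z z′) → φ z ≡ φ z′ ⊎ T (H (φ z) (φ z′))) →
           ∀ {x y} → Walk G P x y → Walk H Q (φ x) (φ y)
walk-map φ keeps-P keeps-edge (here p) = here (keeps-P p)
walk-map {H = H} {Q = Q} φ keeps-P keeps-edge {y = y} (step p e w) with keeps-edge e
... | inj₁ same = subst (λ x → Walk H Q x (φ y)) (sym same) (walk-map φ keeps-P keeps-edge w)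
... | inj₂ e′   = step (keeps-P p) e′ (walk-map φ keeps-P keeps-edge w)

walk-weaken : ∀ {n} {G : Graph n} {P Q : Fin n → Set} → (∀ {z} → P z → Q z) →
              ∀ {x y} → Walk G P x y → Walk G Q x y
walk-weaken P⇒Q = walk-map (λ z → z) P⇒Q inj₂

adjacent⇒≢ : ∀ {n} {G : Graph n} → Simple G → ∀ {x y} → T (G x y) → x ≢ y
adjacent⇒≢ (_ , loopless) {x} e refl = subst T (loopless x) e

another : ∀ {n} → 2 ≤ n → (x : Fin n) → ∃ λ y → y ≢ x
another (s≤s (s≤s _)) zero    = suc zero , λ ()
another (s≤s (s≤s _)) (suc _) = zero , λ ()

has-neighbour : ∀ {n} {G : Graph n} → Connected G → 2 ≤ n → ∀ v → ∃ λ u → T (G v u)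
has-neighbour {G = G} connected 2≤n v with another 2≤n v
... | y , y≢v = first-step (connected v y) y≢v
  where
  first-step : ∀ {x} → Walk G (λ _ → ⊤) v x → x ≢ v → ∃ λ u → T (G v u)
  first-step (here _)               x≢v = ⊥-elim (x≢v refl)
  first-step (step {y = u} _ vu _)  _   = u , vu

module _ {n} (G : Graph n) (Q : Fin n → Set) where
  IsPath : Fin n → List (Fin n) → Fin n → Set
  IsPath x zs y = Unique seq × Linked (λ a b → T (G a b)) seq × All Q seq
    where
    seq : List (Fin n)
    seq = x ∷ zs ++ y ∷ []

  Path : Fin n → Fin n → Set
  Path x y = x ≡ y ⊎ ∃ λ zs → IsPath x zs y

  path-suffix : ∀ {x h y} zs → Any (x ≡_) (h ∷ zs ++ y ∷ []) → IsPath h zs y → Path x y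
  path-suffix zs       (Any.here refl)              p = inj₂ (zs , p)
  path-suffix []       (Any.there (Any.here refl))  p = inj₁ refl
  path-suffix []       (Any.there (Any.there ()))
  path-suffix (z ∷ zs) (Any.there x∈) (_ ∷ u , _ ∷ l , _ ∷ qs) = path-suffix zs x∈ (u , l , qs)

  -- Prepending an edge to a path gives a path, shortcutting if the new
  -- vertex already lies on it.
  path-cons : ∀ {x y z} → Q x → T (G x y) → Q y → Path y z → Path x z
  path-cons {x} {z = z} qx e qy (inj₁ refl) with x ≟ z
  ... | yes x≡z = inj₁ x≡z
  ... | no  x≢z = inj₂ ([] , ((x≢z ∷ []) ∷ [] ∷ []) , (e ∷ [-]) , (qx ∷ qy ∷ []))
  path-cons {x} {y} {z} qx e _ (inj₂ (zs , p@(u , l , qs))) with Any.any? (x ≟_) (y ∷ zs ++ z ∷ [])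
  ... | yes x∈ = path-suffix zs x∈ p
  ... | no  x∉ = inj₂ (y ∷ zs , (¬Any⇒All¬ _ x∉ ∷ u) , (e ∷ l) , (qx ∷ qs))

  walk⇒path : ∀ {x y} → Walk G Q x y → Path x y
  walk⇒path (here _)     = inj₁ refl
  walk⇒path (step q e w) = path-cons q e (walk-source w) (walk⇒path w)

-- In an acyclic simple graph, two distinct neighbours of v cannot be joined
-- by a walk avoiding v: a path between them would close a cycle through v.
neighbours-separated : ∀ {n} {G : Graph n} → Simple G → ¬ HasCycle G →
  ∀ {v a b} → a ≢ b → T (G v a) → T (G v b) → ¬ Walk G (_≢ v) a b
neighbours-separated {G = G} (symmetric , _) acyclic {v} a≢b va vb w
  with walk⇒path G (_≢ v) w
... | inj₁ a≡b = a≢b a≡b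
... | inj₂ (zs , unique , linked , avoid) =
  acyclic (v , _ ∷ zs , _ , s≤s z≤n , (All.map ≢-sym avoid ∷ unique) , (va ∷ linked) ,
           subst T (symmetric v _) vb)

reach-avoiding : ∀ {n} {G : Graph n} {D : Subset n} → (∀ x → x ∉ D → ∃ λ y → y ∈ D × T (G x y)) →
  ∀ {v c} → v ∉ D → c ≢ v → ∃ λ c′ → c′ ∈ D × Walk G (_≢ v) c c′
reach-avoiding {D = D} dominating {c = c} v∉D c≢v with c ∈? D
... | yes c∈D = c , c∈D , here c≢v
... | no  c∉D with dominating c c∉D
... | c′ , c′∈D , cc′ = c′ , c′∈D , step c≢v cc′ (here λ { refl → v∉D c′∈D })

branch-vertex-in-cds : ∀ {n} {G : Graph n} → Tree G → ∀ {v a b} → a ≢ b → T (G v a) → T (G v b) →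
  ∀ {D} → IsConnDomSet G D → v ∈ D
branch-vertex-in-cds (simple , _ , acyclic) {v} {a} {b} a≢b va vb {D} (dominating , connected)
  with v ∈? D
... | yes v∈D = v∈D
... | no  v∉D
  with reach-avoiding dominating v∉D (≢-sym (adjacent⇒≢ simple va))
     | reach-avoiding dominating v∉D (≢-sym (adjacent⇒≢ simple vb))
... | a′ , a′∈D , a→a′ | b′ , b′∈D , b→b′ =
  ⊥-elim (neighbours-separated simple acyclic a≢b va vb
           (a→a′ ++ʷ walk-weaken (λ { z∈D refl → v∉D z∈D }) (connected a′ b′ a′∈D b′∈D)
                 ++ʷ walk-reverse (proj₁ simple) b→b′))

module LeafRemoval {n} {G : Graph n} (simple : Simple G) {v u : Fin n}
                   (vu : T (G v u)) (only-u : ∀ {x} → T (G v x) → x ≡ u)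
                   {w : Fin n} (w≢u : w ≢ u) (w≢v : w ≢ v)
                   {D : Subset n} (cds : IsConnDomSet G D) (v∈D : v ∈ D) where

  dominating : ∀ x → x ∉ D → ∃ λ y → y ∈ D × T (G x y)
  dominating = proj₁ cds

  connected : ∀ x y → x ∈ D → y ∈ D → Walk G (_∈ D) x y
  connected = proj₂ cds

  u≢v : u ≢ v
  u≢v = ≢-sym (adjacent⇒≢ simple vu)

  into-v : ∀ {x} → T (G x v) → x ≡ u
  into-v e = only-u (subst T (proj₁ simple _ v) e)

  -- D has a vertex besides v: w itself, or the vertex dominating w (which is
  -- not v, because w is not adjacent to v).
  other-member : ∃ λ y → y ∈ D × y ≢ v
  other-member with w ∈? D
  ... | yes w∈D = w , w∈D , w≢v
  ... | no  w∉D with dominating w w∉D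
  ... | y , y∈D , wy = y , y∈D , λ { refl → w≢u (into-v wy) }

  -- A walk inside D from v to another vertex leaves v through u.
  u∈D : u ∈ D
  u∈D with other-member
  ... | y , y∈D , y≢v = leave (connected v y v∈D y∈D) y≢v
    where
    leave : ∀ {x} → Walk G (_∈ D) v x → x ≢ v → u ∈ D
    leave (here _)     x≢v = ⊥-elim (x≢v refl)
    leave (step _ e w) _   = subst (_∈ D) (only-u e) (walk-source w)

  remaining-dominating : ∀ x → x ∉ D - v → ∃ λ y → y ∈ D - v × T (G x y)
  remaining-dominating x x∉ with x ≟ v
  ... | yes refl = u , x∈p∧x≢y⇒x∈p-y u∈D u≢v , vu
  ... | no  x≢v with x ∈? D
  ... | yes x∈D = ⊥-elim (x∉ (x∈p∧x≢y⇒x∈p-y x∈D x≢v))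
  ... | no  x∉D with dominating x x∉D
  ... | y , y∈D , xy with y ≟ v
  ... | no  y≢v  = y , x∈p∧x≢y⇒x∈p-y y∈D y≢v , xy
  ... | yes refl = ⊥-elim (x∉D (subst (_∈ D) (sym (into-v xy)) u∈D))

  -- Contracting v onto u turns walks inside D into walks inside D - v.
  contract : Fin n → Fin n
  contract x with x ≟ v
  ... | yes _ = u
  ... | no  _ = x

  contract-fixes : ∀ {x} → x ≢ v → contract x ≡ x
  contract-fixes {x} x≢v with x ≟ v
  ... | yes x≡v = ⊥-elim (x≢v x≡v)
  ... | no  _   = refl

  contract-member : ∀ {x} → x ∈ D → contract x ∈ D - v
  contract-member {x} x∈D with x ≟ v
  ... | yes _   = x∈p∧x≢y⇒x∈p-y u∈D u≢v
  ... | no  x≢v = x∈p∧x≢y⇒x∈p-y x∈D x≢v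

  contract-edge : ∀ {x y} → T (G x y) → contract x ≡ contract y ⊎ T (G (contract x) (contract y))
  contract-edge {x} {y} e with x ≟ v | y ≟ v
  ... | yes _    | yes _ = inj₁ refl
  ... | yes refl | no  _ = inj₁ (sym (only-u e))
  ... | no  _    | yes refl = inj₁ (into-v e)
  ... | no  _    | no  _ = inj₂ e

  remaining-connected : ∀ x y → x ∈ D - v → y ∈ D - v → Walk G (_∈ D - v) x y
  remaining-connected x y x∈ y∈ with ∈-remove⁻ x∈ | ∈-remove⁻ y∈
  ... | x∈D , x≢v | y∈D , y≢v =
    subst₂ (Walk G (_∈ D - v)) (contract-fixes x≢v) (contract-fixes y≢v)
      (walk-map contract contract-member contract-edge (connected x y x∈D y∈D))

  leaf-removed : IsConnDomSet G (D - v) × ∣ D - v ∣ < ∣ D ∣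
  leaf-removed = (remaining-dominating , remaining-connected) , x∈p⇒∣p-x∣<∣p∣ v∈D

neighbourhood : ∀ {n} → Graph n → Fin n → Subset n
neighbourhood G v = tabulate (G v)

module _ {n} {G : Graph n} {v : Fin n} where
  ∈-neighbourhood⁺ : ∀ {x} → T (G v x) → x ∈ neighbourhood G v
  ∈-neighbourhood⁺ e = ∈-tabulate⁺ (to T-≡ e)

  ∈-neighbourhood⁻ : ∀ {x} → x ∈ neighbourhood G v → T (G v x)
  ∈-neighbourhood⁻ x∈ = from T-≡ (∈-tabulate⁻ x∈)

  degree≡1⇒unique-neighbour : degree G v ≡ 1 → ∀ {a b} → T (G v a) → T (G v b) → a ≡ b
  degree≡1⇒unique-neighbour deg≡1 {a} {b} va vb with a ≟ b
  ... | yes a≡b = a≡b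
  ... | no  a≢b with subst (2 ≤_) deg≡1 (distinct⇒2≤size (∈-neighbourhood⁺ va) (∈-neighbourhood⁺ vb) a≢b)
  ... | s≤s ()

  degree≢1⇒second-neighbour : ¬ degree G v ≡ 1 → ∀ {u} → T (G v u) → ∃ λ b → T (G v b) × b ≢ u
  degree≢1⇒second-neighbour deg≢1 {u} vu with any? (λ b → T? (G v b) ×-dec ¬? (b ≟ u))
  ... | yes second = second
  ... | no  none   = ⊥-elim (deg≢1 (only-element⇒size≡1 (∈-neighbourhood⁺ vu) only-u))
    where
    only-u : ∀ {x} → x ∈ neighbourhood G v → x ≡ u
    only-u {x} x∈ = decidable-stable (x ≟ u) (λ x≢u → none (x , ∈-neighbourhood⁻ x∈ , x≢u))

MinimumCDSThrough : ∀ {n} → Graph n → ℕ → Fin n → Set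
MinimumCDSThrough {n} G k v = Σ (Subset n) λ D → IsConnDomSet G D × v ∈ D × ∣ D ∣ ≡ k

third : ∀ {n} → 3 ≤ n → (x y : Fin n) → ∃ λ z → z ≢ x × z ≢ y
third (s≤s (s≤s (s≤s _))) zero          zero          = suc zero , (λ ()) , (λ ())
third (s≤s (s≤s (s≤s _))) zero          (suc zero)    = suc (suc zero) , (λ ()) , (λ ())
third (s≤s (s≤s (s≤s _))) zero          (suc (suc _)) = suc zero , (λ ()) , (λ ())
third (s≤s (s≤s (s≤s _))) (suc zero)    zero          = suc (suc zero) , (λ ()) , (λ ())
third (s≤s (s≤s (s≤s _))) (suc zero)    (suc _)       = zero , (λ ()) , (λ ())
third (s≤s (s≤s (s≤s _))) (suc (suc _)) zero          = suc zero , (λ ()) , (λ ())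
third (s≤s (s≤s (s≤s _))) (suc (suc _)) (suc _)       = zero , (λ ()) , (λ ())

root-in-minimum⇔non-leaf : ∀ {n} {G : Graph n} {v k} → 3 ≤ n → Tree G → IsConnDomNumber G k →
  MinimumCDSThrough G k v ⇔ (¬ degree G v ≡ 1)
root-in-minimum⇔non-leaf {n} {G} {v} {k} 3≤n tree@(simple , connected , _) ((D₀ , cds₀ , size₀) , minimal) =
  mk⇔ leaf-excluded non-leaf-included
  where
  neighbour : ∃ λ u → T (G v u)
  neighbour = has-neighbour connected (≤-trans (n≤1+n 2) 3≤n) v
  u : Fin n
  u = proj₁ neighbour
  vu : T (G v u)
  vu = proj₂ neighbour

  -- A leaf can be removed from any connected dominating set containing it.
  leaf-excluded : MinimumCDSThrough G k v → ¬ degree G v ≡ 1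
  leaf-excluded (D , cds , v∈D , size) deg≡1 with third 3≤n u v
  ... | w , w≢u , w≢v = <-irrefl refl (≤-<-trans (minimal _ (proj₁ leaf-removed)) smaller)
    where
    open LeafRemoval simple vu (λ vx → degree≡1⇒unique-neighbour {G = G} deg≡1 vx vu) w≢u w≢v cds v∈D
    smaller : ∣ D - v ∣ < k
    smaller = subst (∣ D - v ∣ <_) size (proj₂ leaf-removed)

  -- A vertex with two distinct neighbours lies in every connected dominating set.
  non-leaf-included : ¬ degree G v ≡ 1 → MinimumCDSThrough G k v
  non-leaf-included deg≢1 with degree≢1⇒second-neighbour {G = G} deg≢1 vu
  ... | b , vb , b≢u = D₀ , cds₀ , branch-vertex-in-cds tree b≢u vb vu cds₀ , size₀

module RootedProduct {n₁ n₂ : ℕ} (T₁ : Graph n₁) (T₂ : Graph n₂) (v : Fin n₂) where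

  P : Graph (n₁ * n₂)
  P = rootedProduct T₁ T₂ v

  copy : Fin (n₁ * n₂) → Fin n₁
  copy a = proj₁ (remQuot {n₁} n₂ a)

  position : Fin (n₁ * n₂) → Fin n₂
  position a = proj₂ (remQuot {n₁} n₂ a)

  copy-combine : ∀ i j → copy (combine i j) ≡ i
  copy-combine i j = cong proj₁ (remQuot-combine {n₁} {n₂} i j)

  position-combine : ∀ i j → position (combine i j) ≡ j
  position-combine i j = cong proj₂ (remQuot-combine {n₁} {n₂} i j)

  in-copy : ∀ {a i} → copy a ≡ i → combine i (position a) ≡ a
  in-copy {a} refl = combine-remQuot {n₁} n₂ a

  adjacent : Fin n₁ × Fin n₂ → Fin n₁ × Fin n₂ → Bool
  adjacent (i , j) (i′ , j′) = (⌊ i ≟ i′ ⌋ ∧ T₂ j j′) ∨ (⌊ j ≟ v ⌋ ∧ ⌊ j′ ≟ v ⌋ ∧ T₁ i i′)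

  adjacent-combine : ∀ i j i′ j′ → P (combine i j) (combine i′ j′) ≡ adjacent (i , j) (i′ , j′)
  adjacent-combine i j i′ j′ = cong₂ adjacent (remQuot-combine {n₁} {n₂} i j) (remQuot-combine {n₁} {n₂} i′ j′)

  adjacent-cases : ∀ i j i′ j′ → T (adjacent (i , j) (i′ , j′)) →
                   (i ≡ i′ × T (T₂ j j′)) ⊎ (j ≡ v × j′ ≡ v × T (T₁ i i′))
  adjacent-cases i j i′ j′ e with to (T-∨ {⌊ i ≟ i′ ⌋ ∧ T₂ j j′}) e
  ... | inj₁ inside = let (same , e₂) = to (T-∧ {⌊ i ≟ i′ ⌋}) inside
                      in inj₁ (toWitness {a? = i ≟ i′} same , e₂)
  ... | inj₂ roots  = let (j-root , rest) = to (T-∧ {⌊ j ≟ v ⌋}) roots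
                          (j′-root , e₁)  = to (T-∧ {⌊ j′ ≟ v ⌋}) rest
                      in inj₂ (toWitness {a? = j ≟ v} j-root , toWitness {a? = j′ ≟ v} j′-root , e₁)

  edge-cases : ∀ {a b} → T (P a b) →
    (copy a ≡ copy b × T (T₂ (position a) (position b))) ⊎
    (position a ≡ v × position b ≡ v × T (T₁ (copy a) (copy b)))
  edge-cases {a} {b} = adjacent-cases (copy a) (position a) (copy b) (position b)

  copy-edge : ∀ i {j j′} → T (T₂ j j′) → T (P (combine i j) (combine i j′))
  copy-edge i {j} {j′} e =
    subst T (sym (adjacent-combine i j i j′))
      (from (T-∨ {⌊ i ≟ i ⌋ ∧ T₂ j j′}) (inj₁ (from (T-∧ {⌊ i ≟ i ⌋}) (fromWitness {a? = i ≟ i} refl , e))))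

  root-edge : ∀ {i i′} → T (T₁ i i′) → T (P (combine i v) (combine i′ v))
  root-edge {i} {i′} e =
    subst T (sym (adjacent-combine i v i′ v))
      (from (T-∨ {⌊ i ≟ i′ ⌋ ∧ T₂ v v}) (inj₂ (from (T-∧ {⌊ v ≟ v ⌋}) (fromWitness {a? = v ≟ v} refl ,
        from (T-∧ {⌊ v ≟ v ⌋}) (fromWitness {a? = v ≟ v} refl , e)))))

  -- A walk that starts in copy i and ends outside it passes through the root
  -- of copy i, the only vertex of copy i with neighbours in other copies.
  leaves-through-root : ∀ {Q a b} i → Walk P Q a b → copy a ≡ i → copy b ≢ i → Q (combine i v)
  leaves-through-root i (here q) a-in b-out = ⊥-elim (b-out a-in)
  leaves-through-root {Q} i (step {x = a} {y = a′} q e w) a-in b-out with copy a′ ≟ i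
  ... | yes a′-in = leaves-through-root i w a′-in b-out
  ... | no  a′-out with edge-cases e
  ... | inj₁ (same , _)      = ⊥-elim (a′-out (trans (sym same) a-in))
  ... | inj₂ (a-root , _ , _) = subst Q (trans (sym (in-copy a-in)) (cong (combine i) a-root)) q

  project : Fin n₁ → Fin (n₁ * n₂) → Fin n₂
  project i a with copy a ≟ i
  ... | yes _ = position a
  ... | no  _ = v

  project-combine : ∀ i j → project i (combine i j) ≡ j
  project-combine i j with copy (combine i j) ≟ i
  ... | yes _  = position-combine i j
  ... | no  ne = ⊥-elim (ne (copy-combine i j))

  project-edge : ∀ i {a b} → T (P a b) → project i a ≡ project i b ⊎ T (T₂ (project i a) (project i b))
  project-edge i {a} {b} e with copy a ≟ i | copy b ≟ i | edge-cases e
  ... | yes _     | yes _     | inj₁ (_ , e₂)        = inj₂ e₂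
  ... | yes _     | yes _     | inj₂ (a-root , b-root , _) = inj₁ (trans a-root (sym b-root))
  ... | yes a-in  | no  b-out | inj₁ (same , _)      = ⊥-elim (b-out (trans (sym same) a-in))
  ... | yes _     | no  _     | inj₂ (a-root , _ , _) = inj₁ a-root
  ... | no  a-out | yes b-in  | inj₁ (same , _)      = ⊥-elim (a-out (trans same b-in))
  ... | no  _     | yes _     | inj₂ (_ , b-root , _) = inj₁ (sym b-root)
  ... | no  _     | no  _     | _                    = inj₁ refl

  part : Subset (n₁ * n₂) → Fin n₁ → Subset n₂
  part D i = preimage (combine i) D

  spread : Subset n₂ → Subset (n₁ * n₂)
  spread D₂ = preimage position D₂

  size-by-parts : ∀ D → ∣ D ∣ ≡ ∑[ i < n₁ ] ∣ part D i ∣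
  size-by-parts D = begin
    ∣ D ∣                                              ≡⟨ size-count D ⟩
    count (lookup D)                                   ≡⟨ sum-combine n₁ n₂ _ ⟩
    ∑[ i < n₁ ] count (λ j → lookup D (combine i j))
      ≡⟨ sum-cong-≗ {n₁} (λ i → sym (size-tabulate (λ j → lookup D (combine i j)))) ⟩
    ∑[ i < n₁ ] ∣ part D i ∣                           ∎
    where open ≡-Reasoning

  part-spread : ∀ D₂ i → part (spread D₂) i ≡ D₂
  part-spread D₂ i = trans (tabulate-cong λ j → trans (lookup∘tabulate _ (combine i j))
                                                      (cong (lookup D₂) (position-combine i j)))
                           (tabulate∘lookup D₂)

  size-spread : ∀ D₂ → ∣ spread D₂ ∣ ≡ n₁ * ∣ D₂ ∣
  size-spread D₂ = begin
    ∣ spread D₂ ∣                        ≡⟨ size-by-parts (spread D₂) ⟩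
    ∑[ i < n₁ ] ∣ part (spread D₂) i ∣   ≡⟨ sum-cong-≗ {n₁} (λ i → cong ∣_∣ (part-spread D₂ i)) ⟩
    ∑[ i < n₁ ] ∣ D₂ ∣                   ≡⟨ sum-const n₁ ∣ D₂ ∣ ⟩
    n₁ * ∣ D₂ ∣                          ∎
    where open ≡-Reasoning

  module _ (2≤n₁ : 2 ≤ n₁) (2≤n₂ : 2 ≤ n₂) {D : Subset (n₁ * n₂)} (cds : IsConnDomSet P D) where

    -- A non-root vertex u of copy i is in D or dominated from inside copy i.
    meets-copy : ∀ i → ∃ λ a → a ∈ D × copy a ≡ i
    meets-copy i with another 2≤n₂ v
    ... | u , u≢v with combine i u ∈? D
    ... | yes iu∈D = combine i u , iu∈D , copy-combine i u
    ... | no  iu∉D with proj₁ cds (combine i u) iu∉D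
    ... | a , a∈D , e with edge-cases e
    ... | inj₁ (same , _)        = a , a∈D , trans (sym same) (copy-combine i u)
    ... | inj₂ (u-root , _ , _)  = ⊥-elim (u≢v (trans (sym (position-combine i u)) u-root))

    -- D meets copy i and some other copy, so its connecting walk crosses the root.
    root-in-cds : ∀ i → combine i v ∈ D
    root-in-cds i with another 2≤n₁ i
    ... | i′ , i′≢i with meets-copy i | meets-copy i′
    ... | a , a∈D , a-in | b , b∈D , b-in =
      leaves-through-root i (proj₂ cds a b a∈D b∈D) a-in (λ b-in′ → i′≢i (trans (sym b-in) b-in′))

    -- A vertex of copy i outside D is dominated from inside copy i, since the
    -- root of copy i is in D.
    part-dominating : ∀ i j → j ∉ part D i → ∃ λ j′ → j′ ∈ part D i × T (T₂ j j′)
    part-dominating i j j∉ with proj₁ cds (combine i j) (λ ij∈D → j∉ (∈-preimage⁺ ij∈D))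
    ... | a , a∈D , e with edge-cases e
    ... | inj₁ (same , e₂) =
      position a , ∈-preimage⁺ (subst (_∈ D) (sym (in-copy (trans (sym same) (copy-combine i j)))) a∈D) ,
      subst (λ j₀ → T (T₂ j₀ (position a))) (position-combine i j) e₂
    ... | inj₂ (j-root , _ , _) =
      ⊥-elim (j∉ (∈-preimage⁺ (subst (λ j₀ → combine i j₀ ∈ D)
                                     (sym (trans (sym (position-combine i j)) j-root)) (root-in-cds i))))

    project-member : ∀ i {a} → a ∈ D → project i a ∈ part D i
    project-member i {a} a∈D with copy a ≟ i
    ... | yes a-in = ∈-preimage⁺ (subst (_∈ D) (sym (in-copy a-in)) a∈D)
    ... | no  _    = ∈-preimage⁺ (root-in-cds i)

    part-connected : ∀ i j j′ → j ∈ part D i → j′ ∈ part D i → Walk T₂ (_∈ part D i) j j′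
    part-connected i j j′ j∈ j′∈ =
      subst₂ (Walk T₂ (_∈ part D i)) (project-combine i j) (project-combine i j′)
        (walk-map (project i) (project-member i) (project-edge i)
          (proj₂ cds (combine i j) (combine i j′) (∈-preimage⁻ j∈) (∈-preimage⁻ j′∈)))

    part-cds : ∀ i → IsConnDomSet T₂ (part D i)
    part-cds i = part-dominating i , part-connected i

  module _ (connected₁ : Connected T₁) {D₂ : Subset n₂} (cds₂ : IsConnDomSet T₂ D₂) (v∈D₂ : v ∈ D₂) where

    ∈-spread : ∀ i {j} → j ∈ D₂ → combine i j ∈ spread D₂
    ∈-spread i {j} j∈D₂ = ∈-preimage⁺ (subst (_∈ D₂) (sym (position-combine i j)) j∈D₂)

    spread-dominating : ∀ a → a ∉ spread D₂ → ∃ λ b → b ∈ spread D₂ × T (P a b)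
    spread-dominating a a∉ with proj₁ cds₂ (position a) (λ a∈ → a∉ (∈-preimage⁺ a∈))
    ... | j′ , j′∈D₂ , e =
      combine (copy a) j′ , ∈-spread (copy a) j′∈D₂ ,
      subst (λ a₀ → T (P a₀ (combine (copy a) j′))) (in-copy refl) (copy-edge (copy a) e)

    lift-copy : ∀ i {j j′} → Walk T₂ (_∈ D₂) j j′ → Walk P (_∈ spread D₂) (combine i j) (combine i j′)
    lift-copy i = walk-map (combine i) (∈-spread i) (λ e → inj₂ (copy-edge i e))

    lift-roots : ∀ {i i′} → Walk T₁ (λ _ → ⊤) i i′ → Walk P (_∈ spread D₂) (combine i v) (combine i′ v)
    lift-roots = walk-map (λ i → combine i v) (λ {i} _ → ∈-spread i v∈D₂) (λ e → inj₂ (root-edge e))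

    -- From a to the root of its copy, across T₁ to the root of b's copy, then to b.
    spread-connected : ∀ a b → a ∈ spread D₂ → b ∈ spread D₂ → Walk P (_∈ spread D₂) a b
    spread-connected a b a∈ b∈ =
      subst₂ (Walk P (_∈ spread D₂)) (in-copy refl) (in-copy refl)
        (lift-copy (copy a) (proj₂ cds₂ (position a) v (∈-preimage⁻ a∈) v∈D₂) ++ʷ
         lift-roots (connected₁ (copy a) (copy b)) ++ʷ
         lift-copy (copy b) (proj₂ cds₂ v (position b) v∈D₂ (∈-preimage⁻ b∈)))

    spread-cds : IsConnDomSet P (spread D₂)
    spread-cds = spread-dominating , spread-connected

  γc-product⇔root-in-minimum : 2 ≤ n₁ → 2 ≤ n₂ → Connected T₁ → ∀ {k k₂} →
    IsConnDomNumber P k → IsConnDomNumber T₂ k₂ → (k ≡ n₁ * k₂) ⇔ MinimumCDSThrough T₂ k₂ v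
  γc-product⇔root-in-minimum 2≤n₁ 2≤n₂ connected₁ {k} {k₂} ((D , cds , size) , minimal) (_ , minimal₂) =
    mk⇔ parts-minimum spread-minimum
    where
    part-size : ∀ i → k₂ ≤ ∣ part D i ∣
    part-size i = minimal₂ _ (part-cds 2≤n₁ 2≤n₂ cds i)

    sum-parts : ∑[ i < n₁ ] ∣ part D i ∣ ≡ k
    sum-parts = trans (sym (size-by-parts D)) size

    -- If |D| = n₁ γc(T₂), every part of D is minimum, and it contains its root.
    parts-minimum : k ≡ n₁ * k₂ → MinimumCDSThrough T₂ k₂ v
    parts-minimum k≡ =
      part D i , part-cds 2≤n₁ 2≤n₂ cds i , ∈-preimage⁺ (root-in-cds 2≤n₁ 2≤n₂ cds i) ,
      sum-tight _ part-size (trans sum-parts k≡) i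
      where
      i : Fin n₁
      i = Fin.fromℕ< (≤-trans (s≤s z≤n) 2≤n₁)

    -- Spreading a minimum set through the root attains the lower bound n₁ γc(T₂).
    spread-minimum : MinimumCDSThrough T₂ k₂ v → k ≡ n₁ * k₂
    spread-minimum (D₂ , cds₂ , v∈D₂ , size₂) = ≤-antisym upper lower
      where
      upper : k ≤ n₁ * k₂
      upper = subst (k ≤_) (trans (size-spread D₂) (cong (n₁ *_) size₂))
                    (minimal _ (spread-cds connected₁ cds₂ v∈D₂))
      lower : n₁ * k₂ ≤ k
      lower = subst (n₁ * k₂ ≤_) sum-parts (sum-lower _ part-size)

mainTheorem9 : (n₁ n₂ : ℕ) (T₁ : Graph n₁) (T₂ : Graph n₂) (v : Fin n₂) →
    3 ≤ n₁ → 3 ≤ n₂ → Tree T₁ → Tree T₂ →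
    (k k₂ : ℕ) → IsConnDomNumber (rootedProduct T₁ T₂ v) k → IsConnDomNumber T₂ k₂ →
    ((k ≡ n₁ * k₂) ⇔ (¬ (degree T₂ v ≡ 1)))
mainTheorem9 n₁ n₂ T₁ T₂ v 3≤n₁ 3≤n₂ tree₁ tree₂ k k₂ γc-product γc₂ =
  root-in-minimum⇔non-leaf 3≤n₂ tree₂ γc₂
    ⇔-∘ RootedProduct.γc-product⇔root-in-minimum T₁ T₂ v (2≤ 3≤n₁) (2≤ 3≤n₂) connected₁ γc-product γc₂
  where
  2≤ : ∀ {n} → 3 ≤ n → 2 ≤ n
  2≤ = ≤-trans (n≤1+n 2)
  connected₁ : Connected T₁
  connected₁ = proj₁ (proj₂ tree₁)
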